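{- Let $p$ be a prime and let $f:\mathbb{Z}_p\to\mathbb{Z}_p$ be a measure-preserving 1-Lipschitz function with van der Put expansion $f(x)=\sum_{m=0}^{\infty}B_m\chi(m,x)$. For integers $n\ge2$ and $p^{n-1}\le m\le p^n-1$, write $B_m=p^{n-1}b_m$ with $b_m=b_{m0}+b_{m1}p+b_{m2}p^2+\cdots$, where $0\le b_{mi}\le p-1$ and $b_{m0}\neq0$. Then for all $n\ge2$, $$\sum_{m=p^{n-1}}^{p^n-1}B_m\equiv\tfrac12(p-1)p^{2n-1}+T_np^n\pmod{p^{n+1}},\qquad\text{where } T_n=\sum_{m=p^{n-1}}^{p^n-1}b_{m1}.$$
   Context: $\mathbb{Z}_p$ is the ring of $p$-adic integers with absolute value $|x|_p=p^{ -\mathrm{ord}(x)}$ and normalized Haar measure $\mu_p$. A function $f:\mathbb{Z}_p\to\mathbb{Z}_p$ is 1-Lipschitz if $|f(x)-f(y)|_p\le|x-y|_p$ for all $x,y$; it is measure-preserving if $\mu_p(f^{ -1}(S))=\mu_p(S)$ for every measurable $S$. For an integer $m>0$ with base-$p$ expansion $m=m_0+m_1p+\dots+m_sp^s$ ($0\le m_i\le p-1$, $m_s\ne0$), put $q(m)=m_sp^s$. The van der Put basis is: for $m>0$, $\chi(m,x)=1$ if $|x-m|_p\le p^{ -\lfloor\log_p m\rfloor-1}$ and $0$ otherwise; $\chi(0,x)=1$ if $|x|_p\le p^{ -1}$ and $0$ otherwise. Every continuous $f:\mathbb{Z}_p\to\mathbb{Z}_p$ has a unique expansion $f(x)=\sum_{m\ge0}B_m\chi(m,x)$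 with $B_m\in\mathbb{Z}_p$, where $B_m=f(m)$ for $0\le m\le p-1$ and $B_m=f(m)-f(m-q(m))$ for $m\ge p$. (For measure-preserving 1-Lipschitz $f$ one has $|B_m|_p=p^{ -(n-1)}$ for $p^{n-1}\le m\le p^n-1$, so $b_m$ is a unit.) -}

module Defs where

open import Data.Nat using (ℕ; zero; suc; _+_; _*_; _∸_; _^_; _/_; _%_; _<ᵇ_; NonZero; nonTrivial⇒nonZero)
open import Data.Nat.Properties using (m^n≢0)
open import Data.Nat.Primality using (Prime; prime⇒nonZero)
open import Data.Fin using (Fin; toℕ; fromℕ<)
open import Data.Nat.DivMod using (m%n<n)
open import Data.Bool using (Bool; true; false; if_then_else_)
open import Data.List using (List; map; upTo; foldr; filter; length)
open import Data.Integer using (ℤ; +_; _-_) renaming (_+_ to _+ℤ_)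
open import Data.Integer.DivMod using (_%ℕ_)
open import Relation.Binary.PropositionalEquality using (_≡_)
open import Relation.Nullary.Decidable using (Dec)
import Data.Nat as ℕ

-- The p-adic integers ℤ_p, represented by their digit sequences:
-- x = Σ_i (x i) p^i with 0 ≤ x i ≤ p-1.
ℤp : ℕ → Set
ℤp p = ℕ → Fin p

res : {p : ℕ} → ℕ → ℤp p → ℕ
res {p} zero    x = 0
res {p} (suc k) x = res k x + toℕ (x k) * p ^ k

module _ (p : ℕ) (pr : Prime p) where

  private
    instance
      nz : NonZero p
      nz = prime⇒nonZero pr

  emb : ℕ → ℤp p
  emb m i = fromℕ< (m%n<n (m / p ^ i) p)
    where instance _ = m^n≢0 p i

  -- 1-Lipschitz: |x - y|_p ≤ p^{-k} (i.e. x ≡ y mod p^k) implies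
  -- |f x - f y|_p ≤ p^{-k}, for every k.
  OneLipschitz : (ℤp p → ℤp p) → Set
  OneLipschitz f = ∀ k x y → res k x ≡ res k y → res k (f x) ≡ res k (f y)

  -- For a 1-Lipschitz f, the preimage of the ball B(a,k) = {y : y ≡ a mod p^k}
  -- (0 ≤ a < p^k) is the disjoint union of the balls B(r,k), 0 ≤ r < p^k, with
  -- f(r) ≡ a mod p^k; its Haar measure is (number of such r) / p^k.
  preimageBallCount : (ℤp p → ℤp p) → ℕ → ℕ → ℕ
  preimageBallCount f k a =
    length (filter (λ r → res k (f (emb r)) ℕ.≟ a) (upTo (p ^ k)))

  -- Measure-preserving (tested on the balls, which form a π-system generating
  -- the Borel σ-algebra): μ(f⁻¹(B(a,k))) = μ(B(a,k)) = p^{-k}, i.e. the count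
  -- above equals 1.
  MeasurePreserving : (ℤp p → ℤp p) → Set
  MeasurePreserving f = ∀ k a → a ℕ.< p ^ k → preimageBallCount f k a ≡ 1

  -- ⌊log_p m⌋ for m ≥ 1 (computed with fuel m, which is sufficient).
  ilog : ℕ → ℕ
  ilog m = go m m
    where
    go : ℕ → ℕ → ℕ
    go zero    m = 0
    go (suc t) m = if m <ᵇ p then 0 else suc (go t (m / p))

  -- q(m) = m_s p^s, where s = ⌊log_p m⌋ and m_s is the leading digit.
  q : ℕ → ℕ
  q m = (m / p ^ ilog m) * p ^ ilog m
    where instance _ = m^n≢0 p (ilog m)

  -- Van der Put coefficient B_m, reduced modulo p^k (as an integer
  -- representative): B_m = f(m) for m < p, B_m = f(m) - f(m - q(m)) for m ≥ p.
  vdP : (ℤp p → ℤp p) → ℕ → ℕ → ℤ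
  vdP f k m = if m <ᵇ p then + res k (f (emb m))
              else (+ res k (f (emb m)) - + res k (f (emb (m ∸ q m))))

  vdPmod : (ℤp p → ℤp p) → ℕ → ℕ → ℕ
  vdPmod f k m = vdP f k m %ℕ (p ^ k)
    where instance _ = m^n≢0 p k

  -- For p^{n-1} ≤ m ≤ p^n - 1, B_m = p^{n-1} b_m and b_{m1} (the digit of p^1
  -- in b_m) is the digit of p^n in B_m, i.e. ⌊(B_m mod p^{n+1}) / p^n⌋.
  bm1 : (ℤp p → ℤp p) → ℕ → ℕ → ℕ
  bm1 f n m = vdPmod f (suc n) m / p ^ n
    where instance _ = m^n≢0 p n

  range : ℕ → List ℕ
  range n = map (λ i → p ^ (n ∸ 1) + i) (upTo (p ^ n ∸ p ^ (n ∸ 1)))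

  sumB : (ℤp p → ℤp p) → ℕ → ℕ → ℤ
  sumB f k n = foldr _+ℤ_ (+ 0) (map (vdP f k) (range n))

  T : (ℤp p → ℤp p) → ℕ → ℕ
  T f n = foldr _+_ 0 (map (bm1 f n) (range n))

  modP : ℕ → ℤ → ℕ
  modP k x = x %ℕ (p ^ k)
    where instance _ = m^n≢0 p k

-- Write m ∈ [p^{n-1}, p^n) as m = J p^{n-1} + r with 1 ≤ J < p and r < p^{n-1}, so that
-- m - q(m) = r and B_m = f(m) - f(r). Since f is 1-Lipschitz, f(m) ≡ f(r) mod p^{n-1}, hence
-- B_m ≡ b_{m0} p^{n-1} mod p^n, where b_{m0} is the difference mod p of the digits of p^{n-1}
-- in f(m) and f(r). Since f is measure-preserving, it is injective mod p^n, so for fixed r the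
-- map J ↦ b_{m0}, extended by 0 at J = 0, permutes {0, …, p-1}, and the residues B_m mod p^n
-- add up to p^{n-1} · p^{n-1} · p(p-1)/2. The digit of p^n in B_m is b_{m1}, which contributes T_n p^n.
-- The resulting identity is exact for the representatives B_m mod p^{n+1}.

module Submission where

open import Defs
open import Data.Nat
open import Data.Nat.Properties
open import Data.Nat.DivMod
open import Data.Nat.Divisibility using (n∣m*n)
open import Data.Nat.Primality using (Prime; prime⇒nonZero; prime⇒nonTrivial)
open import Data.Nat.Tactic.RingSolver using () renaming (solve-∀ to solve-∀ℕ)
open import Data.Bool using (true; false; if_then_else_)
open import Data.Bool.Properties using (T-≡)
open import Data.Fin using (Fin; toℕ; fromℕ<; punchOut)
open import Data.Fin.Properties
  using (toℕ-fromℕ<; toℕ<n; toℕ-injective; any?; punchOut-injective; injective⇒≤)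
  renaming (_≟_ to _≟ᶠ_)
open import Data.Fin.Permutation using (permutation)
open import Data.Integer as ℤ using (ℤ; +_; 0ℤ; ∣_∣; _%ℕ_; _/ℕ_)
  renaming (_+_ to _+ℤ_; _-_ to _-ℤ_; _*_ to _*ℤ_)
open import Data.Integer.DivMod using (n%ℕd<d; a≡a%ℕn+[a/ℕn]*n)
import Data.Integer.Properties as ℤₚ
open import Data.Integer.Tactic.RingSolver using (solve-∀)
open import Data.List using (List; []; _∷_; foldr; map; applyUpTo; length; upTo)
open import Data.List.Properties using (map-∘; map-applyUpTo)
open import Data.List.Membership.Propositional using (_∈_)
open import Data.List.Membership.Propositional.Properties using (∈-filter⁺; ∈-upTo⁺)
open import Data.List.Relation.Unary.Any using (here)
open import Data.Product using (_×_; _,_; proj₁; proj₂)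
open import Algebra.Properties.Semiring.Sum +-*-semiring
  using (sum; sum-syntax; sum-cong-≗; ∑-distrib-+; ∑-comm; ∑-permute; *-distribʳ-sum)
open import Function using (id; _∘_; Equivalence)
open import Function.Definitions using (Injective; StrictlySurjective)
open import Relation.Binary.PropositionalEquality
open import Relation.Nullary using (yes; no)
open import Relation.Nullary.Negation using (contradiction)

-- Residues of integers

∣k*d∣<d⇒k*d≡0 : ∀ k {d} → ∣ k *ℤ + d ∣ < d → k *ℤ + d ≡ 0ℤ
∣k*d∣<d⇒k*d≡0 (+ zero)       _  = refl
∣k*d∣<d⇒k*d≡0 k@(ℤ.+[1+ j ]) {d} ∣kd∣<d =
  contradiction (subst (_< d) (ℤₚ.abs-* k (+ d)) ∣kd∣<d) (≤⇒≯ (m≤m+n d (j * d)))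
∣k*d∣<d⇒k*d≡0 k@(ℤ.-[1+ j ]) {d} ∣kd∣<d =
  contradiction (subst (_< d) (ℤₚ.abs-* k (+ d)) ∣kd∣<d) (≤⇒≯ (m≤m+n d (j * d)))

+m-+n≡k*d⇒m≡n : ∀ {m n d} k → m < d → n < d → + m -ℤ + n ≡ k *ℤ + d → m ≡ n
+m-+n≡k*d⇒m≡n {m} {n} {d} k m<d n<d eq = ℤₚ.+-injective (ℤₚ.i-j≡0⇒i≡j (+ m) (+ n)
  (trans eq (∣k*d∣<d⇒k*d≡0 k (subst (λ i → ∣ i ∣ < d) eq ∣m-n∣<d))))
  where
  ∣m-n∣<d : ∣ + m -ℤ + n ∣ < d
  ∣m-n∣<d = subst (_< d) (cong ∣_∣ (sym (ℤₚ.m-n≡m⊖n m n)))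
    (≤-<-trans (ℤₚ.∣m⊝n∣≤m⊔n m n) (⊔-lub m<d n<d))

i≡r+k*d⇒i%ℕd≡r : ∀ {i r d} .{{_ : NonZero d}} k → r < d → i ≡ + r +ℤ k *ℤ + d → i %ℕ d ≡ r
i≡r+k*d⇒i%ℕd≡r {i} {r} {d} k r<d i≡ = +m-+n≡k*d⇒m≡n (k -ℤ Q) (n%ℕd<d i d) r<d (begin
  + (i %ℕ d) -ℤ + r
    ≡⟨ regroup (+ (i %ℕ d)) Q (+ r) (+ d) ⟩
  (+ (i %ℕ d) +ℤ Q *ℤ + d) -ℤ + r -ℤ Q *ℤ + d
    ≡⟨ cong (λ j → j -ℤ + r -ℤ Q *ℤ + d) (trans (sym (a≡a%ℕn+[a/ℕn]*n i d)) i≡) ⟩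
  (+ r +ℤ k *ℤ + d) -ℤ + r -ℤ Q *ℤ + d
    ≡⟨ cancel (+ r) k Q (+ d) ⟩
  (k -ℤ Q) *ℤ + d ∎)
  where
  open ≡-Reasoning
  Q = i /ℕ d
  regroup : ∀ a u b c → a -ℤ b ≡ (a +ℤ u *ℤ c) -ℤ b -ℤ u *ℤ c
  regroup = solve-∀
  cancel : ∀ b k u c → (b +ℤ k *ℤ c) -ℤ b -ℤ u *ℤ c ≡ (k -ℤ u) *ℤ c
  cancel = solve-∀

[i+k*d]%ℕd≡i%ℕd : ∀ {d} .{{_ : NonZero d}} i k → (i +ℤ k *ℤ + d) %ℕ d ≡ i %ℕ d
[i+k*d]%ℕd≡i%ℕd {d} i k = i≡r+k*d⇒i%ℕd≡r (i /ℕ d +ℤ k) (n%ℕd<d i d) (begin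
  i +ℤ k *ℤ + d                             ≡⟨ cong (_+ℤ k *ℤ + d) (a≡a%ℕn+[a/ℕn]*n i d) ⟩
  (+ (i %ℕ d) +ℤ i /ℕ d *ℤ + d) +ℤ k *ℤ + d ≡⟨ collect (+ (i %ℕ d)) (i /ℕ d) k (+ d) ⟩
  + (i %ℕ d) +ℤ (i /ℕ d +ℤ k) *ℤ + d        ∎)
  where
  open ≡-Reasoning
  collect : ∀ r u k c → (r +ℤ u *ℤ c) +ℤ k *ℤ c ≡ r +ℤ (u +ℤ k) *ℤ c
  collect = solve-∀

i%ℕ[c*d]%d≡i%ℕd : ∀ c {d} .{{_ : NonZero d}} .{{_ : NonZero (c * d)}} i →
  i %ℕ (c * d) % d ≡ i %ℕ d
i%ℕ[c*d]%d≡i%ℕd c {d} i = sym (begin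
  i %ℕ d                          ≡⟨ cong (_%ℕ d) (a≡a%ℕn+[a/ℕn]*n i (c * d)) ⟩
  (+ r +ℤ Q *ℤ + (c * d)) %ℕ d    ≡⟨ cong (λ j → (+ r +ℤ j) %ℕ d) reassoc ⟩
  (+ r +ℤ (Q *ℤ + c) *ℤ + d) %ℕ d ≡⟨ [i+k*d]%ℕd≡i%ℕd (+ r) (Q *ℤ + c) ⟩
  r % d                           ∎)
  where
  open ≡-Reasoning
  r = i %ℕ (c * d)
  Q = i /ℕ (c * d)
  reassoc : Q *ℤ + (c * d) ≡ (Q *ℤ + c) *ℤ + d
  reassoc = trans (cong (Q *ℤ_) (ℤₚ.pos-* c d)) (sym (ℤₚ.*-assoc Q (+ c) (+ d)))

i*d%ℕ[n*d]≡i%ℕn*d : ∀ n {d} .{{_ : NonZero n}} .{{_ : NonZero d}} .{{_ : NonZero (n * d)}} i →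
  (i *ℤ + d) %ℕ (n * d) ≡ i %ℕ n * d
i*d%ℕ[n*d]≡i%ℕn*d n {d} i = i≡r+k*d⇒i%ℕd≡r Q (*-monoˡ-< d (n%ℕd<d i n)) (begin
  i *ℤ + d                          ≡⟨ cong (_*ℤ + d) (a≡a%ℕn+[a/ℕn]*n i n) ⟩
  (+ r +ℤ Q *ℤ + n) *ℤ + d          ≡⟨ distrib (+ r) Q (+ n) (+ d) ⟩
  + r *ℤ + d +ℤ Q *ℤ (+ n *ℤ + d)
    ≡⟨ cong₂ (λ a b → a +ℤ Q *ℤ b) (ℤₚ.pos-* r d) (ℤₚ.pos-* n d) ⟨
  + (r * d) +ℤ Q *ℤ + (n * d)       ∎)
  where
  open ≡-Reasoning
  r = i %ℕ n
  Q = i /ℕ n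
  distrib : ∀ r u a b → (r +ℤ u *ℤ a) *ℤ b ≡ r *ℤ b +ℤ u *ℤ (a *ℤ b)
  distrib = solve-∀

[+m-+o]%ℕd≡[+n-+o]%ℕd⇒m≡n : ∀ {m n o d} .{{_ : NonZero d}} → m < d → n < d →
  (+ m -ℤ + o) %ℕ d ≡ (+ n -ℤ + o) %ℕ d → m ≡ n
[+m-+o]%ℕd≡[+n-+o]%ℕd⇒m≡n {m} {n} {o} {d} m<d n<d eq =
  +m-+n≡k*d⇒m≡n (x /ℕ d -ℤ y /ℕ d) m<d n<d (begin
    + m -ℤ + n
      ≡⟨ shift (+ m) (+ n) (+ o) ⟩
    x -ℤ y
      ≡⟨ cong₂ _-ℤ_ (a≡a%ℕn+[a/ℕn]*n x d) (a≡a%ℕn+[a/ℕn]*n y d) ⟩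
    (+ (x %ℕ d) +ℤ x /ℕ d *ℤ + d) -ℤ (+ (y %ℕ d) +ℤ y /ℕ d *ℤ + d)
      ≡⟨ cong (λ r → (+ r +ℤ x /ℕ d *ℤ + d) -ℤ (+ (y %ℕ d) +ℤ y /ℕ d *ℤ + d)) eq ⟩
    (+ (y %ℕ d) +ℤ x /ℕ d *ℤ + d) -ℤ (+ (y %ℕ d) +ℤ y /ℕ d *ℤ + d)
      ≡⟨ cancel (+ (y %ℕ d)) (x /ℕ d) (y /ℕ d) (+ d) ⟩
    (x /ℕ d -ℤ y /ℕ d) *ℤ + d ∎)
  where
  open ≡-Reasoning
  x = + m -ℤ + o
  y = + n -ℤ + o
  shift : ∀ a b c → a -ℤ b ≡ (a -ℤ c) -ℤ (b -ℤ c)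
  shift = solve-∀
  cancel : ∀ r a b c → (r +ℤ a *ℤ c) -ℤ (r +ℤ b *ℤ c) ≡ (a -ℤ b) *ℤ c
  cancel = solve-∀

foldr-+-%ℕ : ∀ {d} .{{_ : NonZero d}} xs →
  foldr _+ℤ_ 0ℤ xs %ℕ d ≡ (+ foldr _+_ 0 (map (_%ℕ d) xs)) %ℕ d
foldr-+-%ℕ {d} xs = trans (cong (_%ℕ d) (decompose xs))
  ([i+k*d]%ℕd≡i%ℕd (+ foldr _+_ 0 (map (_%ℕ d) xs)) (foldr _+ℤ_ 0ℤ (map (_/ℕ d) xs)))
  where
  open ≡-Reasoning
  collect : ∀ r u s k c → (r +ℤ u *ℤ c) +ℤ (s +ℤ k *ℤ c) ≡ (r +ℤ s) +ℤ (u +ℤ k) *ℤ c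
  collect = solve-∀
  decompose : ∀ xs → foldr _+ℤ_ 0ℤ xs ≡
    + foldr _+_ 0 (map (_%ℕ d) xs) +ℤ foldr _+ℤ_ 0ℤ (map (_/ℕ d) xs) *ℤ + d
  decompose []       = refl
  decompose (x ∷ xs) = begin
    x +ℤ foldr _+ℤ_ 0ℤ xs
      ≡⟨ cong₂ _+ℤ_ (a≡a%ℕn+[a/ℕn]*n x d) (decompose xs) ⟩
    (+ (x %ℕ d) +ℤ x /ℕ d *ℤ + d) +ℤ (+ s +ℤ k *ℤ + d)
      ≡⟨ collect (+ (x %ℕ d)) (x /ℕ d) (+ s) k (+ d) ⟩
    (+ (x %ℕ d) +ℤ + s) +ℤ (x /ℕ d +ℤ k) *ℤ + d
      ≡⟨ cong (_+ℤ (x /ℕ d +ℤ k) *ℤ + d) (ℤₚ.pos-+ (x %ℕ d) s) ⟨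
    + (x %ℕ d + s) +ℤ (x /ℕ d +ℤ k) *ℤ + d ∎
    where
    s = foldr _+_ 0 (map (_%ℕ d) xs)
    k = foldr _+ℤ_ 0ℤ (map (_/ℕ d) xs)

[a+b*c+d*e]-[a+b′*c+d′*e] : ∀ a b b′ c d d′ e →
  + (a + b * c + d * e) -ℤ + (a + b′ * c + d′ * e) ≡ (+ b -ℤ + b′) *ℤ + c +ℤ (+ d -ℤ + d′) *ℤ + e
[a+b*c+d*e]-[a+b′*c+d′*e] a b b′ c d d′ e = trans
  (cong₂ _-ℤ_ (cast a b c d e) (cast a b′ c d′ e))
  (cancel (+ a) (+ b) (+ b′) (+ c) (+ d) (+ d′) (+ e))
  where
  cast : ∀ a b c d e → + (a + b * c + d * e) ≡ + a +ℤ + b *ℤ + c +ℤ + d *ℤ + e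
  cast a b c d e = trans (ℤₚ.pos-+ (a + b * c) (d * e))
    (cong₂ _+ℤ_ (trans (ℤₚ.pos-+ a (b * c)) (cong (+ a +ℤ_) (ℤₚ.pos-* b c))) (ℤₚ.pos-* d e))
  cancel : ∀ a b b′ c d d′ e → (a +ℤ b *ℤ c +ℤ d *ℤ e) -ℤ (a +ℤ b′ *ℤ c +ℤ d′ *ℤ e)
                               ≡ (b -ℤ b′) *ℤ c +ℤ (d -ℤ d′) *ℤ e
  cancel = solve-∀

-- Finite sums

foldr-applyUpTo : ∀ k (g : ℕ → ℕ) → foldr _+_ 0 (applyUpTo g k) ≡ ∑[ i < k ] g (toℕ i)
foldr-applyUpTo zero    g = refl
foldr-applyUpTo (suc k) g = cong (_+_ (g 0)) (foldr-applyUpTo k (g ∘ suc))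

∑-const : ∀ k c → ∑[ i < k ] c ≡ k * c
∑-const zero    c = refl
∑-const (suc k) c = cong (_+_ c) (∑-const k c)

∑-split : ∀ a b (g : ℕ → ℕ) →
  ∑[ i < a + b ] g (toℕ i) ≡ ∑[ i < a ] g (toℕ i) + ∑[ i < b ] g (a + toℕ i)
∑-split zero    b g = refl
∑-split (suc a) b g = trans (cong (_+_ (g 0)) (∑-split a b (g ∘ suc))) (sym (+-assoc (g 0) _ _))

∑-blocks : ∀ a b (g : ℕ → ℕ) →
  ∑[ i < a * b ] g (toℕ i) ≡ ∑[ j < a ] ∑[ r < b ] g (toℕ j * b + toℕ r)
∑-blocks zero    b g = refl
∑-blocks (suc a) b g = begin
  ∑[ i < b + a * b ] g (toℕ i)
    ≡⟨ ∑-split b (a * b) g ⟩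
  ∑[ r < b ] g (toℕ r) + ∑[ i < a * b ] g (b + toℕ i)
    ≡⟨ cong (_+_ (∑[ r < b ] g (toℕ r))) (∑-blocks a b (g ∘ _+_ b)) ⟩
  ∑[ r < b ] g (toℕ r) + ∑[ j < a ] ∑[ r < b ] g (b + (toℕ j * b + toℕ r))
    ≡⟨ cong (_+_ (∑[ r < b ] g (toℕ r)))
         (sum-cong-≗ {a} λ j → sum-cong-≗ {b} λ r → cong g (sym (+-assoc b _ _))) ⟩
  ∑[ j < suc a ] ∑[ r < b ] g (toℕ j * b + toℕ r) ∎
  where open ≡-Reasoning

∑-toℕ*2 : ∀ k → (∑[ i < k ] toℕ i) * 2 ≡ k * (k ∸ 1)
∑-toℕ*2 zero    = refl
∑-toℕ*2 (suc k) = begin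
  (∑[ i < k ] suc (toℕ i)) * 2          ≡⟨ cong (_* 2) (∑-distrib-+ {k} (λ _ → 1) toℕ) ⟩
  (∑[ i < k ] 1 + ∑[ i < k ] toℕ i) * 2 ≡⟨ cong (λ c → (c + S) * 2) (trans (∑-const k 1) (*-identityʳ k)) ⟩
  (k + S) * 2                           ≡⟨ *-distribʳ-+ 2 k S ⟩
  k * 2 + S * 2                         ≡⟨ cong (_+_ (k * 2)) (∑-toℕ*2 k) ⟩
  k * 2 + k * (k ∸ 1)                   ≡⟨ step k ⟩
  suc k * k                             ∎
  where
  open ≡-Reasoning
  S = ∑[ i < k ] toℕ i
  step : ∀ k → k * 2 + k * (k ∸ 1) ≡ suc k * k
  step zero       = refl
  step k@(suc j) = trans (sym (*-distribˡ-+ k 2 j)) (*-comm k (suc k))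

injective⇒strictlySurjective : ∀ {k} {h : Fin k → Fin k} →
  Injective _≡_ _≡_ h → StrictlySurjective _≡_ h
injective⇒strictlySurjective {suc k} {h} inj j with any? (λ i → h i ≟ᶠ j)
... | yes hit  = hit
... | no  miss = contradiction (injective⇒≤ h′-injective) (<-irrefl refl)
  where
  j≢h : ∀ i → j ≢ h i
  j≢h i j≡hi = miss (i , sym j≡hi)
  h′ : Fin (suc k) → Fin k
  h′ i = punchOut (j≢h i)
  h′-injective : Injective _≡_ _≡_ h′
  h′-injective {x} {y} eq = inj (punchOut-injective (j≢h x) (j≢h y) eq)

∑-∘-injective : ∀ {k} (g : Fin k → ℕ) {h : Fin k → Fin k} → Injective _≡_ _≡_ h →
  ∑[ i < k ] g (h i) ≡ sum g
∑-∘-injective g {h} inj =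
  sym (∑-permute g (permutation h h⁻¹ (proj₂ ∘ onto) (λ i → inj (proj₂ (onto (h i))))))
  where
  onto = injective⇒strictlySurjective inj
  h⁻¹ = proj₁ ∘ onto

-- Digits

<⇒<ᵇ≡true : ∀ {m n} → m < n → (m <ᵇ n) ≡ true
<⇒<ᵇ≡true m<n = Equivalence.to T-≡ (<⇒<ᵇ m<n)

≤⇒<ᵇ≡false : ∀ {m n} → n ≤ m → (m <ᵇ n) ≡ false
≤⇒<ᵇ≡false {m} {n} n≤m with m <ᵇ n in m<ᵇn
... | false = refl
... | true  = contradiction (<ᵇ⇒< m n (Equivalence.from T-≡ m<ᵇn)) (≤⇒≯ n≤m)

m+n*o<k*o : ∀ {m n o k} → m < o → n < k → m + n * o < k * o
m+n*o<k*o {m} {n} {o} {k} m<o n<k = begin-strict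
  m + n * o <⟨ +-monoˡ-< (n * o) m<o ⟩
  o + n * o ≤⟨ *-monoˡ-≤ o n<k ⟩
  k * o     ∎
  where open ≤-Reasoning

length≡1⇒∈-unique : ∀ {A : Set} {xs : List A} {x y} → length xs ≡ 1 → x ∈ xs → y ∈ xs → x ≡ y
length≡1⇒∈-unique {xs = _ ∷ []} _ (here refl) (here refl) = refl

module _ (p : ℕ) (pr : Prime p) where

  private instance
    p≢0 : NonZero p
    p≢0 = prime⇒nonZero pr

  1<p : 1 < p
  1<p = nonTrivial⇒n>1 p {{prime⇒nonTrivial pr}}

  p≤p^[1+s] : ∀ s → p ≤ p ^ suc s
  p≤p^[1+s] s = m≤m*n p (p ^ s) {{m^n≢0 p s}}

  /p-step : ∀ s {t y} → y ≤ suc t → p ^ suc s ≤ y → y < p ^ suc (suc s) →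
    y / p ≤ t × p ^ s ≤ y / p × y / p < p ^ suc s
  /p-step s {t} {y} y≤1+t lo hi = y/p≤t , lo′ , hi′
    where
    p≤y : p ≤ y
    p≤y = ≤-trans (p≤p^[1+s] s) lo
    y/p≤t : y / p ≤ t
    y/p≤t = <⇒≤pred (≤-trans (m/n<m y p {{>-nonZero (≤-trans (<⇒≤ 1<p) p≤y)}} 1<p) y≤1+t)
    lo′ : p ^ s ≤ y / p
    lo′ = subst (_≤ y / p) (m*n/n≡m (p ^ s) p) (/-monoˡ-≤ p (subst (_≤ y) (*-comm p (p ^ s)) lo))
    hi′ : y / p < p ^ suc s
    hi′ = m<n*o⇒m/o<n (subst (y <_) (*-comm p (p ^ suc s)) hi)

  fuelledLog-≡ : {loop : ℕ → ℕ → ℕ} →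
    (∀ t y → loop (suc t) y ≡ (if y <ᵇ p then 0 else suc (loop t (y / p)))) →
    ∀ s {t y} → y ≤ t → p ^ s ≤ y → y < p ^ suc s → loop t y ≡ s
  fuelledLog-≡ loop-suc s {zero} y≤0 lo _ = contradiction (≤-trans lo y≤0) (<⇒≱ (m^n>0 p s))
  fuelledLog-≡ {loop} loop-suc zero {suc t} {y} _ _ hi = begin
    loop (suc t) y                               ≡⟨ loop-suc t y ⟩
    (if y <ᵇ p then 0 else suc (loop t (y / p)))
      ≡⟨ cong (if_then 0 else suc (loop t (y / p))) (<⇒<ᵇ≡true (subst (y <_) (*-identityʳ p) hi)) ⟩
    0                                            ∎
    where open ≡-Reasoning
  fuelledLog-≡ {loop} loop-suc (suc s) {suc t} {y} y≤1+t lo hi =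
    let y/p≤t , lo′ , hi′ = /p-step s y≤1+t lo hi in begin
    loop (suc t) y                               ≡⟨ loop-suc t y ⟩
    (if y <ᵇ p then 0 else suc (loop t (y / p)))
      ≡⟨ cong (if_then 0 else suc (loop t (y / p))) (≤⇒<ᵇ≡false (≤-trans (p≤p^[1+s] s) lo)) ⟩
    suc (loop t (y / p))                         ≡⟨ cong suc (fuelledLog-≡ {loop} loop-suc s y/p≤t lo′ hi′) ⟩
    suc s                                        ∎
    where open ≡-Reasoning

  -- `ilog` runs a fuelled loop local to its definition; once the loop's arguments have been
  -- abstracted to variables, unification names it `ilogLoop`.
  mutual
    private
      ilogLoop : ℕ → ℕ → ℕ → ℕ
      ilogLoop = _

    ilog-≡ : ∀ s {x} → p ^ s ≤ x → x < p ^ suc s → ilog p pr x ≡ s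
    ilog-≡ s {zero} lo _ = contradiction lo (<⇒≱ (m^n>0 p s))
    ilog-≡ zero {suc k} _ hi rewrite <⇒<ᵇ≡true (subst (suc k <_) (*-identityʳ p) hi) = refl
    ilog-≡ (suc s) {suc k} lo hi rewrite ≤⇒<ᵇ≡false (≤-trans (p≤p^[1+s] s) lo)
      with suc k / p in x/p≡y
    ... | y with suc k in 1+k≡x
    ...   | x = let x/p≤k , lo′ , hi′ = /p-step s (≤-reflexive (sym 1+k≡x)) lo hi in
      cong suc (fuelledLog-≡ {ilogLoop x} (λ _ _ → refl) s {k} {y}
        (subst (_≤ k) x/p≡y x/p≤k) (subst (p ^ s ≤_) x/p≡y lo′) (subst (_< p ^ suc s) x/p≡y hi′))

  res<pᵏ : ∀ k (x : ℤp p) → res k x < p ^ k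
  res<pᵏ zero    x = z<s
  res<pᵏ (suc k) x = m+n*o<k*o (res<pᵏ k x) (toℕ<n (x k))

  res-emb : ∀ k m .{{_ : NonZero (p ^ k)}} → res k (emb p pr m) ≡ m % p ^ k
  res-emb zero    m = sym (n%1≡0 m)
  res-emb (suc k) m = begin
    res k (emb p pr m) + toℕ (emb p pr m k) * p ^ k
      ≡⟨ cong₂ (λ a b → a + b * p ^ k) (res-emb k m) (toℕ-fromℕ< (m%n<n (m / p ^ k) p)) ⟩
    m % p ^ k + m / p ^ k % p * p ^ k
      ≡⟨ cong₂ (λ a b → a + b * p ^ k) (m∣n⇒o%n%m≡o%m (p ^ k) (p * p ^ k) m (n∣m*n p))
                                      (m%[n*o]/o≡m/o%n m p (p ^ k) {{_}} {{_}} {{m^n≢0 p (suc k)}}) ⟨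
    x % p ^ k + x / p ^ k * p ^ k
      ≡⟨ m≡m%n+[m/n]*n x (p ^ k) ⟨
    x ∎
    where
    open ≡-Reasoning
    instance _ = m^n≢0 p k
    x = m % p ^ suc k

  leading-digit-bounds : ∀ k {J r} → 0 < J → J < p → r < p ^ k →
    p ^ k ≤ J * p ^ k + r × J * p ^ k + r < p ^ suc k
  leading-digit-bounds k {J} {r} 0<J J<p r<pᵏ =
    ≤-trans (m≤n*m (p ^ k) J {{>-nonZero 0<J}}) (m≤m+n (J * p ^ k) r) ,
    subst (_< p * p ^ k) (+-comm r (J * p ^ k)) (m+n*o<k*o r<pᵏ J<p)

  q[J*pᵏ+r]≡J*pᵏ : ∀ k {J r} → 0 < J → J < p → r < p ^ k → q p pr (J * p ^ k + r) ≡ J * p ^ k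
  q[J*pᵏ+r]≡J*pᵏ k {J} {r} 0<J J<p r<pᵏ with lo , hi ← leading-digit-bounds k 0<J J<p r<pᵏ
    rewrite ilog-≡ k lo hi = cong (_* p ^ k) (begin
      (J * p ^ k + r) / p ^ k         ≡⟨ +-distrib-/-∣ˡ r (n∣m*n J) ⟩
      J * p ^ k / p ^ k + r / p ^ k   ≡⟨ cong₂ _+_ (m*n/n≡m J (p ^ k)) (m<n⇒m/n≡0 r<pᵏ) ⟩
      J + 0                           ≡⟨ +-identityʳ J ⟩
      J                               ∎)
    where
    open ≡-Reasoning
    instance _ = m^n≢0 p k

  foldr-range : ∀ n (g : ℕ → ℕ) →
    foldr _+_ 0 (map g (range p pr n)) ≡ ∑[ i < p ^ n ∸ p ^ (n ∸ 1) ] g (p ^ (n ∸ 1) + toℕ i)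
  foldr-range n g = trans
    (cong (foldr _+_ 0) (trans (sym (map-∘ (upTo L))) (map-applyUpTo id (g ∘ _+_ (p ^ (n ∸ 1))) L)))
    (foldr-applyUpTo L (g ∘ _+_ (p ^ (n ∸ 1))))
    where L = p ^ n ∸ p ^ (n ∸ 1)

  module _ (f : ℤp p → ℤp p) where

    vdP-≡-difference : ∀ k N {J r} → 0 < J → J < p → r < p ^ suc k →
      vdP p pr f N (J * p ^ suc k + r)
        ≡ + res N (f (emb p pr (J * p ^ suc k + r))) -ℤ + res N (f (emb p pr r))
    vdP-≡-difference k N {J} {r} 0<J J<p r<pᵏ⁺¹
      rewrite ≤⇒<ᵇ≡false (≤-trans (p≤p^[1+s] k) (proj₁ (leading-digit-bounds (suc k) 0<J J<p r<pᵏ⁺¹)))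
            | q[J*pᵏ+r]≡J*pᵏ (suc k) 0<J J<p r<pᵏ⁺¹
            | m+n∸m≡n (J * p ^ suc k) r = refl

    measurePreserving⇒res-injective : MeasurePreserving p pr f → ∀ k {u v} → u < p ^ k → v < p ^ k →
      res k (f (emb p pr u)) ≡ res k (f (emb p pr v)) → u ≡ v
    measurePreserving⇒res-injective mp k {u} {v} u<pᵏ v<pᵏ fu≡fv =
      length≡1⇒∈-unique (mp k a (res<pᵏ k (f (emb p pr u))))
        (∈-filter⁺ (λ r → res k (f (emb p pr r)) ≟ a) (∈-upTo⁺ u<pᵏ) refl)
        (∈-filter⁺ (λ r → res k (f (emb p pr r)) ≟ a) (∈-upTo⁺ v<pᵏ) (sym fu≡fv))
      where
      a = res k (f (emb p pr u))

  -- The coefficients B_m with p^{n-1} ≤ m < p^n, for n = k + 2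

  module _ (f : ℤp p → ℤp p) (lip : OneLipschitz p pr f) (mp : MeasurePreserving p pr f)
           (k : ℕ) where

    private
      n = suc (suc k)
      pⁿ⁻¹ = p ^ suc k
      pⁿ = p ^ n
      instance
        pⁿ⁻¹≢0 : NonZero pⁿ⁻¹
        pⁿ⁻¹≢0 = m^n≢0 p (suc k)
        pⁿ≢0 : NonZero pⁿ
        pⁿ≢0 = m^n≢0 p n
        pⁿ⁺¹≢0 : NonZero (p * pⁿ)
        pⁿ⁺¹≢0 = m^n≢0 p (suc n)

    B : ℕ → ℕ
    B = vdPmod p pr f (suc n)

    δ : ℕ → ℕ
    δ x = toℕ (f (emb p pr x) (suc k))

    δ<p : ∀ x → δ x < p
    δ<p x = toℕ<n (f (emb p pr x) (suc k))

    -- b₀ J r is the paper's b_{m0} for m = J p^{n-1} + r.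
    b₀ : ℕ → ℕ → ℕ
    b₀ J r = (+ δ (J * pⁿ⁻¹ + r) -ℤ + δ r) %ℕ p

    lower-digits-≡ : ∀ J r →
      res (suc k) (f (emb p pr (J * pⁿ⁻¹ + r))) ≡ res (suc k) (f (emb p pr r))
    lower-digits-≡ J r = lip (suc k) _ _ (begin
      res (suc k) (emb p pr (J * pⁿ⁻¹ + r)) ≡⟨ res-emb (suc k) (J * pⁿ⁻¹ + r) ⟩
      (J * pⁿ⁻¹ + r) % pⁿ⁻¹                 ≡⟨ cong (_% pⁿ⁻¹) (+-comm (J * pⁿ⁻¹) r) ⟩
      (r + J * pⁿ⁻¹) % pⁿ⁻¹                 ≡⟨ [m+kn]%n≡m%n r J pⁿ⁻¹ ⟩
      r % pⁿ⁻¹                              ≡⟨ res-emb (suc k) r ⟨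
      res (suc k) (emb p pr r)              ∎)
      where open ≡-Reasoning

    B%pⁿ : ∀ {J r} → 0 < J → J < p → r < pⁿ⁻¹ → B (J * pⁿ⁻¹ + r) % pⁿ ≡ b₀ J r * pⁿ⁻¹
    B%pⁿ {J} {r} 0<J J<p r<pⁿ⁻¹ = begin
      B m % pⁿ
        ≡⟨ i%ℕ[c*d]%d≡i%ℕd p (vdP p pr f (suc n) m) ⟩
      vdP p pr f (suc n) m %ℕ pⁿ
        ≡⟨ cong (_%ℕ pⁿ) (vdP-≡-difference f k (suc n) 0<J J<p r<pⁿ⁻¹) ⟩
      (+ (res (suc k) (f (emb p pr m)) + δ m * pⁿ⁻¹ + ε m * pⁿ) -ℤ + Fr) %ℕ pⁿ
        ≡⟨ cong (λ a → (+ (a + δ m * pⁿ⁻¹ + ε m * pⁿ) -ℤ + Fr) %ℕ pⁿ) (lower-digits-≡ J r) ⟩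
      (+ (A + δ m * pⁿ⁻¹ + ε m * pⁿ) -ℤ + (A + δ r * pⁿ⁻¹ + ε r * pⁿ)) %ℕ pⁿ
        ≡⟨ cong (_%ℕ pⁿ) ([a+b*c+d*e]-[a+b′*c+d′*e] A (δ m) (δ r) pⁿ⁻¹ (ε m) (ε r) pⁿ) ⟩
      ((+ δ m -ℤ + δ r) *ℤ + pⁿ⁻¹ +ℤ (+ ε m -ℤ + ε r) *ℤ + pⁿ) %ℕ pⁿ
        ≡⟨ [i+k*d]%ℕd≡i%ℕd ((+ δ m -ℤ + δ r) *ℤ + pⁿ⁻¹) (+ ε m -ℤ + ε r) ⟩
      ((+ δ m -ℤ + δ r) *ℤ + pⁿ⁻¹) %ℕ pⁿ
        ≡⟨ i*d%ℕ[n*d]≡i%ℕn*d p (+ δ m -ℤ + δ r) ⟩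
      b₀ J r * pⁿ⁻¹ ∎
      where
      open ≡-Reasoning
      m = J * pⁿ⁻¹ + r
      ε : ℕ → ℕ
      ε x = toℕ (f (emb p pr x) n)
      A = res (suc k) (f (emb p pr r))
      Fr = res (suc n) (f (emb p pr r))

    b₀-zero : ∀ r → b₀ 0 r ≡ 0
    b₀-zero r = trans (cong (_%ℕ p) (ℤₚ.+-inverseʳ (+ δ r))) (m<n⇒m%n≡m (>-nonZero⁻¹ p))

    b₀-injective : ∀ {r J J′} → r < pⁿ⁻¹ → J < p → J′ < p → b₀ J r ≡ b₀ J′ r → J ≡ J′
    b₀-injective {r} {J} {J′} r<pⁿ⁻¹ J<p J′<p b₀-≡ =
      *-cancelʳ-≡ J J′ pⁿ⁻¹ (+-cancelʳ-≡ r (J * pⁿ⁻¹) (J′ * pⁿ⁻¹)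
        (measurePreserving⇒res-injective f mp n (bound J<p) (bound J′<p) resⁿ-≡))
      where
      bound : ∀ {J} → J < p → J * pⁿ⁻¹ + r < pⁿ
      bound J<p = subst (_< pⁿ) (+-comm r _) (m+n*o<k*o r<pⁿ⁻¹ J<p)
      δ-≡ : δ (J * pⁿ⁻¹ + r) ≡ δ (J′ * pⁿ⁻¹ + r)
      δ-≡ = [+m-+o]%ℕd≡[+n-+o]%ℕd⇒m≡n {o = δ r} (δ<p _) (δ<p _) b₀-≡
      resⁿ-≡ : res n (f (emb p pr (J * pⁿ⁻¹ + r))) ≡ res n (f (emb p pr (J′ * pⁿ⁻¹ + r)))
      resⁿ-≡ = cong₂ (λ a d → a + d * pⁿ⁻¹)
        (trans (lower-digits-≡ J r) (sym (lower-digits-≡ J′ r))) δ-≡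

    ∑-b₀ : ∀ {r} → r < pⁿ⁻¹ → ∑[ j < p ∸ 1 ] b₀ (suc (toℕ j)) r ≡ ∑[ i < p ] toℕ i
    ∑-b₀ {r} r<pⁿ⁻¹ = begin
      ∑[ j < p ∸ 1 ] b₀ (suc (toℕ j)) r ≡⟨ cong (_+ ∑[ j < p ∸ 1 ] b₀ (suc (toℕ j)) r) (b₀-zero r) ⟨
      ∑[ J < suc (p ∸ 1) ] b₀ (toℕ J) r ≡⟨ cong (λ q → ∑[ J < q ] b₀ (toℕ J) r) (suc-pred p) ⟩
      ∑[ J < p ] b₀ (toℕ J) r           ≡⟨ sum-cong-≗ {p} (λ J → toℕ-fromℕ< (b₀<p (toℕ J))) ⟨
      ∑[ J < p ] toℕ (b₀-perm J)        ≡⟨ ∑-∘-injective toℕ b₀-perm-injective ⟩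
      ∑[ i < p ] toℕ i                  ∎
      where
      open ≡-Reasoning
      b₀<p : ∀ J → b₀ J r < p
      b₀<p J = n%ℕd<d (+ δ (J * pⁿ⁻¹ + r) -ℤ + δ r) p
      b₀-perm : Fin p → Fin p
      b₀-perm J = fromℕ< (b₀<p (toℕ J))
      b₀-perm-injective : Injective _≡_ _≡_ b₀-perm
      b₀-perm-injective {J} {J′} eq = toℕ-injective (b₀-injective r<pⁿ⁻¹ (toℕ<n J) (toℕ<n J′)
        (trans (sym (toℕ-fromℕ< (b₀<p (toℕ J)))) (trans (cong toℕ eq) (toℕ-fromℕ< (b₀<p (toℕ J′))))))

    ∑-B%pⁿ : ∑[ i < (p ∸ 1) * pⁿ⁻¹ ] (B (pⁿ⁻¹ + toℕ i) % pⁿ)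
             ≡ pⁿ⁻¹ * ((∑[ i < p ] toℕ i) * pⁿ⁻¹)
    ∑-B%pⁿ = begin
      ∑[ i < (p ∸ 1) * pⁿ⁻¹ ] (B (pⁿ⁻¹ + toℕ i) % pⁿ)
        ≡⟨ ∑-blocks (p ∸ 1) pⁿ⁻¹ (λ i → B (pⁿ⁻¹ + i) % pⁿ) ⟩
      ∑[ j < p ∸ 1 ] ∑[ r < pⁿ⁻¹ ] (B (pⁿ⁻¹ + (toℕ j * pⁿ⁻¹ + toℕ r)) % pⁿ)
        ≡⟨ sum-cong-≗ {p ∸ 1} (λ j → sum-cong-≗ {pⁿ⁻¹} (λ r →
             trans (cong (λ m → B m % pⁿ) (sym (+-assoc pⁿ⁻¹ _ _))) (B%pⁿ z<s (1+j<p j) (toℕ<n r)))) ⟩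
      ∑[ j < p ∸ 1 ] ∑[ r < pⁿ⁻¹ ] (b₀ (suc (toℕ j)) (toℕ r) * pⁿ⁻¹)
        ≡⟨ ∑-comm {p ∸ 1} {pⁿ⁻¹} (λ j r → b₀ (suc (toℕ j)) (toℕ r) * pⁿ⁻¹) ⟩
      ∑[ r < pⁿ⁻¹ ] ∑[ j < p ∸ 1 ] (b₀ (suc (toℕ j)) (toℕ r) * pⁿ⁻¹)
        ≡⟨ sum-cong-≗ {pⁿ⁻¹} (λ r →
             *-distribʳ-sum {p ∸ 1} pⁿ⁻¹ (λ j → b₀ (suc (toℕ j)) (toℕ r))) ⟨
      ∑[ r < pⁿ⁻¹ ] ((∑[ j < p ∸ 1 ] b₀ (suc (toℕ j)) (toℕ r)) * pⁿ⁻¹)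
        ≡⟨ sum-cong-≗ {pⁿ⁻¹} (λ r → cong (_* pⁿ⁻¹) (∑-b₀ (toℕ<n r))) ⟩
      ∑[ r < pⁿ⁻¹ ] ((∑[ i < p ] toℕ i) * pⁿ⁻¹)
        ≡⟨ ∑-const pⁿ⁻¹ _ ⟩
      pⁿ⁻¹ * ((∑[ i < p ] toℕ i) * pⁿ⁻¹) ∎
      where
      open ≡-Reasoning
      1+j<p : (j : Fin (p ∸ 1)) → suc (toℕ j) < p
      1+j<p j = subst (suc (toℕ j) <_) (suc-pred p) (s<s (toℕ<n j))

    half-term-≡ : (p ∸ 1) * p ^ (2 * n ∸ 1) / 2 ≡ pⁿ⁻¹ * ((∑[ i < p ] toℕ i) * pⁿ⁻¹)
    half-term-≡ = trans (cong (_/ 2) double) (m*n/n≡m _ 2)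
      where
      open ≡-Reasoning
      G = ∑[ i < p ] toℕ i
      regroup₁ : ∀ a P q → a * (P * (q * P)) ≡ P * ((q * a) * P)
      regroup₁ = solve-∀ℕ
      regroup₂ : ∀ P g → P * ((g * 2) * P) ≡ P * (g * P) * 2
      regroup₂ = solve-∀ℕ
      double : (p ∸ 1) * p ^ (2 * n ∸ 1) ≡ pⁿ⁻¹ * (G * pⁿ⁻¹) * 2
      double = begin
        (p ∸ 1) * p ^ (2 * n ∸ 1)       ≡⟨ cong ((p ∸ 1) *_) (^-distribˡ-+-* p (suc k) (n + 0)) ⟩
        (p ∸ 1) * (pⁿ⁻¹ * p ^ (n + 0))  ≡⟨ cong (λ e → (p ∸ 1) * (pⁿ⁻¹ * p ^ e)) (+-identityʳ n) ⟩
        (p ∸ 1) * (pⁿ⁻¹ * (p * pⁿ⁻¹))   ≡⟨ regroup₁ (p ∸ 1) pⁿ⁻¹ p ⟩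
        pⁿ⁻¹ * ((p * (p ∸ 1)) * pⁿ⁻¹)   ≡⟨ cong (λ g → pⁿ⁻¹ * (g * pⁿ⁻¹)) (∑-toℕ*2 p) ⟨
        pⁿ⁻¹ * ((G * 2) * pⁿ⁻¹)         ≡⟨ regroup₂ pⁿ⁻¹ G ⟩
        pⁿ⁻¹ * (G * pⁿ⁻¹) * 2           ∎

    ∑-B : foldr _+_ 0 (map B (range p pr n)) ≡ (p ∸ 1) * p ^ (2 * n ∸ 1) / 2 + T p pr f n * pⁿ
    ∑-B = begin
      foldr _+_ 0 (map B (range p pr n))
        ≡⟨ foldr-range n B ⟩
      ∑[ i < L ] B (m i)
        ≡⟨ sum-cong-≗ {L} (λ i → m≡m%n+[m/n]*n (B (m i)) pⁿ) ⟩
      ∑[ i < L ] (B (m i) % pⁿ + bm1 p pr f n (m i) * pⁿ)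
        ≡⟨ ∑-distrib-+ {L} (λ i → B (m i) % pⁿ) (λ i → bm1 p pr f n (m i) * pⁿ) ⟩
      ∑[ i < L ] (B (m i) % pⁿ) + ∑[ i < L ] (bm1 p pr f n (m i) * pⁿ)
        ≡⟨ cong₂ _+_ (trans (cong (λ q → ∑[ i < q ] (B (pⁿ⁻¹ + toℕ i) % pⁿ)) L≡) ∑-B%pⁿ)
                     (sym (*-distribʳ-sum {L} pⁿ (λ i → bm1 p pr f n (m i)))) ⟩
      pⁿ⁻¹ * ((∑[ i < p ] toℕ i) * pⁿ⁻¹) + (∑[ i < L ] bm1 p pr f n (m i)) * pⁿ
        ≡⟨ cong₂ _+_ half-term-≡ (cong (_* pⁿ) (foldr-range n (bm1 p pr f n))) ⟨
      (p ∸ 1) * p ^ (2 * n ∸ 1) / 2 + T p pr f n * pⁿ ∎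
      where
      open ≡-Reasoning
      L = pⁿ ∸ pⁿ⁻¹
      m : Fin L → ℕ
      m i = pⁿ⁻¹ + toℕ i
      L≡ : L ≡ (p ∸ 1) * pⁿ⁻¹
      L≡ = sym (trans (*-distribʳ-∸ pⁿ⁻¹ p 1) (cong (pⁿ ∸_) (*-identityˡ pⁿ⁻¹)))

proposition3p4 : (p : ℕ) (pr : Prime p) (f : ℤp p → ℤp p) →
    OneLipschitz p pr f → MeasurePreserving p pr f →
    (n : ℕ) → 2 ≤ n →
    modP p pr (suc n) (sumB p pr f (suc n) n)
      ≡ modP p pr (suc n) (+ ((p ∸ 1) * p ^ (2 * n ∸ 1) / 2 + T p pr f n * p ^ n))
proposition3p4 p pr f lip mp n@(suc (suc k)) (s≤s (s≤s z≤n)) = begin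
  foldr _+ℤ_ 0ℤ (map (vdP p pr f (suc n)) (range p pr n)) %ℕ p ^ suc n
    ≡⟨ foldr-+-%ℕ (map (vdP p pr f (suc n)) (range p pr n)) ⟩
  + foldr _+_ 0 (map (_%ℕ p ^ suc n) (map (vdP p pr f (suc n)) (range p pr n))) %ℕ p ^ suc n
    ≡⟨ cong (λ xs → + foldr _+_ 0 xs %ℕ p ^ suc n) (map-∘ (range p pr n)) ⟨
  + foldr _+_ 0 (map (vdPmod p pr f (suc n)) (range p pr n)) %ℕ p ^ suc n
    ≡⟨ cong (λ s → + s %ℕ p ^ suc n) (∑-B p pr f lip mp k) ⟩
  + ((p ∸ 1) * p ^ (2 * n ∸ 1) / 2 + T p pr f n * p ^ n) %ℕ p ^ suc n ∎
  where
  open ≡-Reasoning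
  instance _ = m^n≢0 p (suc n) {{prime⇒nonZero pr}}
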